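{- Let $\epsilon,\beta\in[\tfrac23,1)$ with $\beta>\epsilon$, and let $k,n,m\geq 1$ be integers with $m\geq kn$ and $n\geq \frac{1}{1-\beta}$. Let $G$ and $H$ be connected graphs with $m$ and $n$ vertices respectively, such that every $\beta$-separation of $G$ has order at least $k$. Then $$\operatorname{tw}(G\square H)\geq (1-\tfrac{\epsilon}{\beta})kn-1.$$
   Context: All graphs are finite and simple. For a graph $G$ and $\epsilon\in[\frac23,1)$, a partition $(A,S,B)$ of $V(G)$ is an $\epsilon$-separation if $1\leq |A|,|B|\leq \epsilon|V(G)|$ and there is no edge between $A$ and $B$; its order is $|S|$. $\operatorname{tw}$ denotes treewidth. The cartesian product $G\square H$ has vertex set $V(G)\times V(H)$, with $(a,v)(b,u)$ an edge iff either $ab\in E(G)$ and $u=v$, or $uv\in E(H)$ and $a=b$. -}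

module Defs where

open import Level using (0ℓ)
open import Data.Nat as ℕ using (ℕ; zero; suc; _⊔_; _∸_)
open import Data.Fin using (Fin; zero; suc; inject₁; fromℕ; remQuot)
open import Data.Fin.Subset using (Subset; _∈_; ∣_∣)
open import Data.Vec using (tabulate)
open import Data.Bool using (Bool; true; false)
open import Data.Product using (Σ; _×_; ∃; proj₁; proj₂)
open import Data.Sum using (_⊎_)
open import Data.Unit using (⊤)
open import Data.Empty using (⊥)
open import Relation.Nullary using (¬_)
open import Relation.Binary.PropositionalEquality using (_≡_; _≢_)
open import Function using (Injective)
open import Data.Integer using (+_)
open import Data.Rational using (ℚ; _/_)

record Graph (n : ℕ) : Set₁ where
  field
    Adj   : Fin n → Fin n → Set
    sym   : ∀ {u v} → Adj u v → Adj v u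
    irrefl : ∀ {u} → ¬ Adj u u
open Graph public

data WalkIn {n : ℕ} (G : Graph n) (P : Fin n → Set) : Fin n → Fin n → Set where
  [_]  : ∀ {x} → P x → WalkIn G P x x
  _∷_  : ∀ {x y z} → P x × Adj G x y → WalkIn G P y z → WalkIn G P x z

Connected : ∀ {n} → Graph n → Set
Connected {n} G = ∀ (x y : Fin n) → WalkIn G (λ _ → ⊤) x y

-- A cycle of length l + 3 (at least 3): injective cyclic sequence of vertices.
record Cycle {n : ℕ} (G : Graph n) : Set where
  field
    l      : ℕ
    c      : Fin (suc (suc (suc l))) → Fin n
    c-inj  : Injective _≡_ _≡_ c
    c-step : ∀ (i : Fin (suc (suc l))) → Adj G (c (inject₁ i)) (c (suc i))
    c-close : Adj G (c (fromℕ (suc (suc l)))) (c zero)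

IsTree : ∀ {t} → Graph t → Set
IsTree T = Connected T × ¬ Cycle T

record TreeDecomposition {m : ℕ} (G : Graph m) : Set₁ where
  field
    t       : ℕ
    T       : Graph t
    tree    : IsTree T
    bag     : Fin t → Subset m
    covers-vertices : ∀ (v : Fin m) → ∃ λ x → v ∈ bag x
    covers-edges    : ∀ (u v : Fin m) → Adj G u v → ∃ λ x → (u ∈ bag x) × (v ∈ bag x)
    subtree : ∀ (v : Fin m) (x y : Fin t) → v ∈ bag x → v ∈ bag y →
              WalkIn T (λ z → v ∈ bag z) x y

maxOver : (t : ℕ) → (Fin t → ℕ) → ℕ
maxOver zero f = 0
maxOver (suc t) f = f zero ⊔ maxOver t (λ i → f (suc i))

width : ∀ {m} {G : Graph m} → TreeDecomposition G → ℕ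
width D = maxOver (TreeDecomposition.t D) (λ x → ∣ TreeDecomposition.bag D x ∣) ∸ 1

ℕtoℚ : ℕ → ℚ
ℕtoℚ n = + n / 1

-- tw(G) ≥ r : every tree decomposition has width ≥ r (tw is the minimum width).
TwAtLeast : ∀ {m} → Graph m → ℚ → Set₁
TwAtLeast G r = ∀ (D : TreeDecomposition G) → r Data.Rational.≤ ℕtoℚ (width D)

-- Partitions (A,S,B) of V(G) as labellings.
data Side : Set where
  sA sS sB : Side

isA isS isB : Side → Bool
isA sA = true
isA _  = false
isS sS = true
isS _  = false
isB sB = true
isB _  = false

sideSet : ∀ {m} → (Side → Bool) → (Fin m → Side) → Subset m
sideSet p side = tabulate (λ v → p (side v))

record Separation {m : ℕ} (G : Graph m) (ε : ℚ) : Set where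
  field
    side : Fin m → Side
    A-nonempty : 1 ℕ.≤ ∣ sideSet isA side ∣
    B-nonempty : 1 ℕ.≤ ∣ sideSet isB side ∣
    A-small : ℕtoℚ ∣ sideSet isA side ∣ Data.Rational.≤ ε Data.Rational.* ℕtoℚ m
    B-small : ℕtoℚ ∣ sideSet isB side ∣ Data.Rational.≤ ε Data.Rational.* ℕtoℚ m
    no-edge : ∀ u v → side u ≡ sA → side v ≡ sB → ¬ Adj G u v

order : ∀ {m} {G : Graph m} {ε} → Separation G ε → ℕ
order s = ∣ sideSet isS (Separation.side s) ∣

-- Cartesian product G □ H, with vertex (a , v) ∈ Fin m × Fin n encoded as
-- combine a v ∈ Fin (m * n) (inverse: remQuot).
_□_ : ∀ {m n} → Graph m → Graph n → Graph (m ℕ.* n)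
_□_ {m} {n} G H = record
  { Adj = λ x y → let p = remQuot {m} n x ; q = remQuot {m} n y in
       (Adj G (proj₁ p) (proj₁ q) × proj₂ p ≡ proj₂ q) ⊎
       (Adj H (proj₂ p) (proj₂ q) × proj₁ p ≡ proj₁ q)
  ; sym = λ { (Data.Sum.inj₁ (e , r)) → Data.Sum.inj₁ (sym G e , Relation.Binary.PropositionalEquality.sym r)
            ; (Data.Sum.inj₂ (e , r)) → Data.Sum.inj₂ (sym H e , Relation.Binary.PropositionalEquality.sym r) }
  ; irrefl = λ { (Data.Sum.inj₁ (e , _)) → irrefl G e ; (Data.Sum.inj₂ (e , _)) → irrefl H e }
  }
  where open Data.Product using (_,_)

module Submission where

-- Suppose every bag of a tree decomposition (T, bag) of G □ H had fewer than (1 − ε/β)kn vertices. For a node x,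
-- each vertex outside bag x lies in the branch of T − x at exactly one neighbour of x, and adjacent vertices outside
-- bag x lie in the same branch. A column G × {v} meeting bag x in fewer than k vertices has more than βm vertices in
-- a single branch, as otherwise grouping the branches would give a β-separation of G of order less than k. Since
-- bag x is small and H is connected, all these columns agree on the branch, and there are enough of them to put more
-- than εmn vertices into it. Sending each node to this heavy neighbour gives a map f with x ~ f x and f (f x) ≠ x
-- (the two branches across an edge are disjoint and ε > 1/2), which cannot exist on a finite tree.

module Counting where

  open import Data.Nat.Base using (ℕ; zero; suc; _+_; _*_; _≤_; _<_; z≤n; s≤s)
  open import Data.Nat.Properties
  open import Data.Bool.Base using (Bool; true; false; not; _∧_)
  open import Data.Fin.Base using (Fin; zero; suc; combine; _↑ˡ_; _↑ʳ_)
  open import Data.Fin.Subset using (Subset; ∣_∣)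
  open import Data.Vec.Base using ([]; _∷_; lookup; tabulate)
  open import Data.Vec.Properties using (lookup∘tabulate)
  open import Data.Product.Base using (Σ; _×_; _,_)
  open import Data.Empty using (⊥; ⊥-elim)
  open import Function.Base using (_∘_)
  open import Relation.Nullary using (¬_; Dec; yes; no; does)
  open import Relation.Binary.PropositionalEquality
  open import Algebra.Properties.CommutativeMonoid.Sum +-0-commutativeMonoid public
    using (sum; sum-syntax; sum-cong-≗; ∑-distrib-+; ∑-comm)

  ∑-mono-≤ : ∀ {n} {f g : Fin n → ℕ} → (∀ i → f i ≤ g i) → sum f ≤ sum g
  ∑-mono-≤ {zero} f≤g = z≤n
  ∑-mono-≤ {suc n} f≤g = +-mono-≤ (f≤g zero) (∑-mono-≤ (f≤g ∘ suc))

  ∑-const : ∀ n c → ∑[ i < n ] c ≡ n * c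
  ∑-const zero c = refl
  ∑-const (suc n) c = cong (c +_) (∑-const n c)

  ∑-↑ : ∀ a b (f : Fin (a + b) → ℕ) → sum f ≡ ∑[ i < a ] f (i ↑ˡ b) + ∑[ j < b ] f (a ↑ʳ j)
  ∑-↑ zero b f = refl
  ∑-↑ (suc a) b f = trans (cong (f zero +_) (∑-↑ a b (f ∘ suc))) (sym (+-assoc (f zero) _ _))

  ∑-combine : ∀ m n (f : Fin (m * n) → ℕ) → sum f ≡ ∑[ a < m ] ∑[ v < n ] f (combine a v)
  ∑-combine zero n f = refl
  ∑-combine (suc m) n f =
    trans (∑-↑ n (m * n) f) (cong (∑[ v < n ] f (v ↑ˡ m * n) +_) (∑-combine m n (f ∘ (n ↑ʳ_))))

  ∑-positive : ∀ {n} (f : Fin n → ℕ) → 0 < sum f → Σ (Fin n) λ i → 0 < f i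
  ∑-positive {suc n} f 0<∑ with f zero in eq
  ... | suc _ = zero , subst (0 <_) (sym eq) (s≤s z≤n)
  ... | zero with ∑-positive (f ∘ suc) 0<∑
  ...   | i , 0<fi = suc i , 0<fi

  ∑-term : ∀ {n} (f : Fin n → ℕ) i → f i ≤ sum f
  ∑-term f zero = m≤m+n _ _
  ∑-term f (suc i) = ≤-trans (∑-term (f ∘ suc) i) (m≤n+m _ _)

  bit : Bool → ℕ
  bit true = 1
  bit false = 0

  count : ∀ {n} → (Fin n → Bool) → ℕ
  count {n} P = ∑[ i < n ] bit (P i)

  bit-≤ : ∀ b {c} → (b ≡ true → 1 ≤ c) → bit b ≤ c
  bit-≤ false _ = z≤n
  bit-≤ true 1≤c = 1≤c refl

  ∣p∣≡count : ∀ {n} (p : Subset n) → ∣ p ∣ ≡ count (lookup p)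
  ∣p∣≡count [] = refl
  ∣p∣≡count (true ∷ p) = cong suc (∣p∣≡count p)
  ∣p∣≡count (false ∷ p) = ∣p∣≡count p

  ∣tabulate∣≡count : ∀ {n} (P : Fin n → Bool) → ∣ tabulate P ∣ ≡ count P
  ∣tabulate∣≡count P = trans (∣p∣≡count (tabulate P)) (sum-cong-≗ (cong bit ∘ lookup∘tabulate P))

  count-cong : ∀ {n} {P Q : Fin n → Bool} → (∀ i → P i ≡ Q i) → count P ≡ count Q
  count-cong P≗Q = sum-cong-≗ (cong bit ∘ P≗Q)

  count-true : ∀ n → count {n} (λ _ → true) ≡ n
  count-true n = trans (∑-const n 1) (*-identityʳ n)

  count-false : ∀ n → count {n} (λ _ → false) ≡ 0
  count-false n = trans (∑-const n 0) (*-zeroʳ n)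

  count-split : ∀ {n} (P Q : Fin n → Bool) →
    count (λ i → P i ∧ Q i) + count (λ i → P i ∧ not (Q i)) ≡ count P
  count-split P Q = trans (sym (∑-distrib-+ (bit ∘ λ i → P i ∧ Q i) (bit ∘ λ i → P i ∧ not (Q i))))
                          (sum-cong-≗ λ i → split (P i) (Q i))
    where
    split : ∀ b c → bit (b ∧ c) + bit (b ∧ not c) ≡ bit b
    split false c = refl
    split true true = refl
    split true false = refl

  count-complement : ∀ {n} (P : Fin n → Bool) → count (not ∘ P) + count P ≡ n
  count-complement {n} P = trans (sym (∑-distrib-+ (bit ∘ not ∘ P) (bit ∘ P)))
                                 (trans (sum-cong-≗ λ i → split (P i)) (count-true n))
    where
    split : ∀ b → bit (not b) + bit b ≡ 1
    split false = refl
    split true = refl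

  count-∧ : ∀ {n} (P Q : Fin n → Bool) → count P + count Q ≤ n + count (λ i → P i ∧ Q i)
  count-∧ {n} P Q = subst₂ _≤_ (∑-distrib-+ (bit ∘ P) (bit ∘ Q))
    (trans (∑-distrib-+ (λ _ → 1) (bit ∘ λ i → P i ∧ Q i)) (cong (_+ count (λ i → P i ∧ Q i)) (count-true n)))
    (∑-mono-≤ λ i → bound (P i) (Q i))
    where
    bound : ∀ b c → bit b + bit c ≤ 1 + bit (b ∧ c)
    bound false false = z≤n
    bound false true = ≤-refl
    bound true false = ≤-refl
    bound true true = ≤-refl

  count-disjoint : ∀ {n} (P Q : Fin n → Bool) → (∀ i → P i ≡ true → Q i ≡ true → ⊥) →
    count P + count Q ≤ n
  count-disjoint {n} P Q disjoint = subst₂ _≤_ (∑-distrib-+ (bit ∘ P) (bit ∘ Q)) (count-true n)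
    (∑-mono-≤ λ i → exclusive (P i) (Q i) (disjoint i))
    where
    exclusive : ∀ b c → (b ≡ true → c ≡ true → ⊥) → bit b + bit c ≤ 1
    exclusive false false _ = z≤n
    exclusive false true _ = ≤-refl
    exclusive true false _ = ≤-refl
    exclusive true true ¬both = ⊥-elim (¬both refl refl)

  count-positive : ∀ {n} (P : Fin n → Bool) → 0 < count P → Σ (Fin n) λ i → P i ≡ true
  count-positive P 0<count with ∑-positive (bit ∘ P) 0<count
  ... | i , 0<bit = i , bit-positive (P i) 0<bit
    where
    bit-positive : ∀ b → 0 < bit b → b ≡ true
    bit-positive true _ = refl

  count≡0⇒false : ∀ {n} (P : Fin n → Bool) → count P ≡ 0 → ∀ i → P i ≡ false
  count≡0⇒false P count≡0 i with P i | ∑-term (bit ∘ P) i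
  ... | false | _ = refl
  ... | true | 1≤count = ⊥-elim (1+n≰n (subst (1 ≤_) count≡0 1≤count))

  ∧-true : ∀ {b c} → b ∧ c ≡ true → b ≡ true × c ≡ true
  ∧-true {true} {true} _ = refl , refl

  not∧-true : ∀ {b c} → not b ∧ c ≡ true → b ≡ false × c ≡ true
  not∧-true {false} {true} _ = refl , refl

  does-true : ∀ {ℓ} {A : Set ℓ} (d : Dec A) → does d ≡ true → A
  does-true (yes a) _ = a

  does-false : ∀ {ℓ} {A : Set ℓ} (d : Dec A) → not (does d) ≡ true → ¬ A
  does-false (no ¬a) _ = ¬a

  crossing : ∀ {ℓ} (Q : ℕ → Set ℓ) → (∀ j → Dec (Q j)) → ¬ Q 0 → ∀ {n} → Q n →
    Σ ℕ λ j → j < n × ¬ Q j × Q (suc j)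
  crossing Q Q? ¬Q0 {zero} Qn = ⊥-elim (¬Q0 Qn)
  crossing Q Q? ¬Q0 {suc n} Qn with Q? n
  ... | no ¬Qn = n , n<1+n n , ¬Qn , Qn
  ... | yes Qn′ with crossing Q Q? ¬Q0 Qn′
  ...   | j , j<n , ¬Qj , Qj+1 = j , m<n⇒m<1+n j<n , ¬Qj , Qj+1

module ℕtoℚ-Properties where

  open import Data.Nat.Base as ℕ using (ℕ; zero; suc)
  import Data.Nat.Properties as ℕ
  open import Data.Integer.Base as ℤ using (+_)
  import Data.Integer.Properties as ℤ
  open import Data.Rational.Base
  open import Data.Rational.Properties
  open import Data.Rational.Unnormalised.Base as ℚᵘ using (mkℚᵘ; *≡*)
  import Data.Rational.Unnormalised.Properties as ℚᵘ
  open import Data.Bool.Base using (Bool; true; false)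
  open import Data.Fin.Base using (Fin; zero; suc)
  open import Data.Product.Base using (_,_)
  open import Function.Base using (_∘_)
  open import Relation.Binary.PropositionalEquality
  open import Defs using (ℕtoℚ)
  open Counting using (bit; count; sum)

  fromℚᵘ-homo-+ : ∀ p q → fromℚᵘ (p ℚᵘ.+ q) ≡ fromℚᵘ p + fromℚᵘ q
  fromℚᵘ-homo-+ p q = toℚᵘ-injective (ℚᵘ.≃-trans (toℚᵘ-fromℚᵘ (p ℚᵘ.+ q)) (ℚᵘ.≃-sym
    (ℚᵘ.≃-trans (toℚᵘ-homo-+ (fromℚᵘ p) (fromℚᵘ q)) (ℚᵘ.+-cong (toℚᵘ-fromℚᵘ p) (toℚᵘ-fromℚᵘ q)))))

  fromℚᵘ-homo-* : ∀ p q → fromℚᵘ (p ℚᵘ.* q) ≡ fromℚᵘ p * fromℚᵘ q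
  fromℚᵘ-homo-* p q = toℚᵘ-injective (ℚᵘ.≃-trans (toℚᵘ-fromℚᵘ (p ℚᵘ.* q)) (ℚᵘ.≃-sym
    (ℚᵘ.≃-trans (toℚᵘ-homo-* (fromℚᵘ p) (fromℚᵘ q)) (ℚᵘ.*-cong (toℚᵘ-fromℚᵘ p) (toℚᵘ-fromℚᵘ q)))))

  -- ℕtoℚ n is definitionally fromℚᵘ (mkℚᵘ (+ n) 0).
  ℕtoℚ-+ : ∀ a b → ℕtoℚ (a ℕ.+ b) ≡ ℕtoℚ a + ℕtoℚ b
  ℕtoℚ-+ a b = trans (fromℚᵘ-cong {mkℚᵘ (+ (a ℕ.+ b)) 0} {mkℚᵘ (+ a) 0 ℚᵘ.+ mkℚᵘ (+ b) 0} (*≡* integral))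
                     (fromℚᵘ-homo-+ (mkℚᵘ (+ a) 0) (mkℚᵘ (+ b) 0))
    where
    integral : + (a ℕ.+ b) ℤ.* + 1 ≡ (+ a ℤ.* + 1 ℤ.+ + b ℤ.* + 1) ℤ.* + 1
    integral = begin
      + (a ℕ.+ b) ℤ.* + 1                   ≡⟨ ℤ.*-identityʳ _ ⟩
      + (a ℕ.+ b)                           ≡⟨ ℤ.pos-+ a b ⟩
      + a ℤ.+ + b                           ≡⟨ cong₂ ℤ._+_ (ℤ.*-identityʳ (+ a)) (ℤ.*-identityʳ (+ b)) ⟨
      + a ℤ.* + 1 ℤ.+ + b ℤ.* + 1           ≡⟨ ℤ.*-identityʳ _ ⟨
      (+ a ℤ.* + 1 ℤ.+ + b ℤ.* + 1) ℤ.* + 1 ∎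
      where open ≡-Reasoning

  ℕtoℚ-* : ∀ a b → ℕtoℚ (a ℕ.* b) ≡ ℕtoℚ a * ℕtoℚ b
  ℕtoℚ-* a b = trans (fromℚᵘ-cong {mkℚᵘ (+ (a ℕ.* b)) 0} {mkℚᵘ (+ a) 0 ℚᵘ.* mkℚᵘ (+ b) 0} (*≡* integral))
                     (fromℚᵘ-homo-* (mkℚᵘ (+ a) 0) (mkℚᵘ (+ b) 0))
    where
    integral : + (a ℕ.* b) ℤ.* + 1 ≡ (+ a ℤ.* + b) ℤ.* + 1
    integral = cong (ℤ._* + 1) (ℤ.pos-* a b)

  ℕtoℚ-nonNeg : ∀ n → 0ℚ ≤ ℕtoℚ n
  ℕtoℚ-nonNeg n = nonNegative⁻¹ (ℕtoℚ n) {{normalize-nonNeg n 1}}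

  ℕtoℚ-mono-≤ : ∀ {a b} → a ℕ.≤ b → ℕtoℚ a ≤ ℕtoℚ b
  ℕtoℚ-mono-≤ {a} a≤b with ℕ.m≤n⇒∃[o]m+o≡n a≤b
  ... | d , refl = begin
    ℕtoℚ a            ≡⟨ +-identityʳ (ℕtoℚ a) ⟨
    ℕtoℚ a + 0ℚ       ≤⟨ +-monoʳ-≤ (ℕtoℚ a) (ℕtoℚ-nonNeg d) ⟩
    ℕtoℚ a + ℕtoℚ d   ≡⟨ ℕtoℚ-+ a d ⟨
    ℕtoℚ (a ℕ.+ d)    ∎
    where open ≤-Reasoning

  ℕtoℚ-mono-< : ∀ {a b} → a ℕ.< b → ℕtoℚ a < ℕtoℚ b
  ℕtoℚ-mono-< {a} {suc b} (ℕ.s≤s a≤b) = begin-strict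
    ℕtoℚ a            ≤⟨ ℕtoℚ-mono-≤ a≤b ⟩
    ℕtoℚ b            ≡⟨ +-identityˡ (ℕtoℚ b) ⟨
    0ℚ + ℕtoℚ b       <⟨ +-monoˡ-< (ℕtoℚ b) {0ℚ} {1ℚ} (*<* (ℤ.+<+ (ℕ.s≤s ℕ.z≤n))) ⟩
    1ℚ + ℕtoℚ b       ≡⟨ ℕtoℚ-+ 1 b ⟨
    ℕtoℚ (suc b)      ∎
    where open ≤-Reasoning

  ℕtoℚ-cancel-< : ∀ {a b} → ℕtoℚ a < ℕtoℚ b → a ℕ.< b
  ℕtoℚ-cancel-< a<b = ℕ.≰⇒> λ b≤a → <-irrefl refl (<-≤-trans a<b (ℕtoℚ-mono-≤ b≤a))

  count*≤∑ : ∀ {n} (P : Fin n → Bool) (f : Fin n → ℕ) (x : ℚ) →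
    (∀ i → P i ≡ true → x ≤ ℕtoℚ (f i)) → ℕtoℚ (count P) * x ≤ ℕtoℚ (sum f)
  count*≤∑ {zero} P f x _ = ≤-reflexive (*-zeroˡ x)
  count*≤∑ {suc n} P f x P⇒x≤f = begin
    ℕtoℚ (bit (P zero) ℕ.+ count (P ∘ suc)) * x
      ≡⟨ trans (cong (_* x) (ℕtoℚ-+ (bit (P zero)) _)) (*-distribʳ-+ x (ℕtoℚ (bit (P zero))) _) ⟩
    ℕtoℚ (bit (P zero)) * x + ℕtoℚ (count (P ∘ suc)) * x
      ≤⟨ +-mono-≤ (head (P zero) refl) (count*≤∑ (P ∘ suc) (f ∘ suc) x (P⇒x≤f ∘ suc)) ⟩
    ℕtoℚ (f zero) + ℕtoℚ (sum (f ∘ suc))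
      ≡⟨ ℕtoℚ-+ (f zero) _ ⟨
    ℕtoℚ (sum f) ∎
    where
    open ≤-Reasoning
    head : ∀ b → P zero ≡ b → ℕtoℚ (bit b) * x ≤ ℕtoℚ (f zero)
    head true P₀ = ≤-trans (≤-reflexive (*-identityˡ x)) (P⇒x≤f zero P₀)
    head false _ = ≤-trans (≤-reflexive (*-zeroˡ x)) (ℕtoℚ-nonNeg (f zero))

module Walks where

  open import Defs using (Graph; Adj; irrefl; WalkIn; [_]; _∷_; Cycle)
  open import Data.Nat.Base as ℕ using (ℕ; zero; suc; z≤n; s≤s)
  import Data.Nat.Properties as ℕ
  open import Data.Nat.GeneralisedArithmetic using (iterate)
  open import Data.Fin.Base using (Fin; zero; suc; inject₁; fromℕ; toℕ)
  open import Data.Fin.Properties using (_≟_; any?; pigeonhole; suc-injective)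
  open import Data.Product.Base using (Σ; _×_; _,_; proj₁; proj₂)
  open import Data.Sum.Base using (_⊎_; inj₁; inj₂)
  open import Data.Empty using (⊥; ⊥-elim)
  open import Relation.Nullary using (¬_; yes; no)
  open import Relation.Binary.PropositionalEquality
  open import Function.Base using (_∘′_)
  open import Function.Definitions using (Injective)

  module _ {t : ℕ} {T : Graph t} where

    map : ∀ {P Q : Fin t → Set} → (∀ {u} → P u → Q u) → ∀ {a b} → WalkIn T P a b → WalkIn T Q a b
    map f [ p ] = [ f p ]
    map f ((p , e) ∷ w) = (f p , e) ∷ map f w

    head : ∀ {P a b} → WalkIn T P a b → P a
    head [ p ] = p
    head ((p , _) ∷ _) = p

    _++_ : ∀ {P a b c} → WalkIn T P a b → WalkIn T P b c → WalkIn T P a c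
    [ _ ] ++ w = w
    (s ∷ w) ++ w′ = s ∷ (w ++ w′)

    snoc : ∀ {P a b c} → WalkIn T P a b → P c → Adj T b c → WalkIn T P a c
    snoc [ p ] pc e = (p , e) ∷ [ pc ]
    snoc (s ∷ w) pc e = s ∷ snoc w pc e

    reverse : ∀ {P a b} → WalkIn T P a b → WalkIn T P b a
    reverse [ p ] = [ p ]
    reverse ((p , e) ∷ w) = snoc (reverse w) p (Graph.sym T e)

    lastExit : ∀ {Q : Fin t → Set} x {a z} → WalkIn T Q a z → z ≢ x →
      WalkIn T (λ u → Q u × u ≢ x) a z ⊎ Σ (Fin t) λ y → Adj T x y × WalkIn T (λ u → Q u × u ≢ x) y z
    lastExit x [ q ] z≢x = inj₁ [ q , z≢x ]
    lastExit x {a} ((q , e) ∷ w) z≢x with lastExit x w z≢x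
    ... | inj₂ exit = inj₂ exit
    ... | inj₁ w′ with a ≟ x
    ...   | yes refl = inj₂ (_ , e , w′)
    ...   | no a≢x = inj₁ (((q , a≢x) , e) ∷ w′)

    length : ∀ {P a b} → WalkIn T P a b → ℕ
    length [ _ ] = 0
    length (_ ∷ w) = suc (length w)

    vertex : ∀ {P a b} (w : WalkIn T P a b) → Fin (suc (length w)) → Fin t
    vertex {a = a} [ _ ] zero = a
    vertex {a = a} (_ ∷ w) zero = a
    vertex (_ ∷ w) (suc i) = vertex w i

    vertex-last : ∀ {P a b} (w : WalkIn T P a b) → vertex w (fromℕ (length w)) ≡ b
    vertex-last [ _ ] = refl
    vertex-last (_ ∷ w) = vertex-last w

    vertex-step : ∀ {P a b} (w : WalkIn T P a b) (i : Fin (length w)) →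
      Adj T (vertex w (inject₁ i)) (vertex w (suc i))
    vertex-step ((_ , e) ∷ [ _ ]) zero = e
    vertex-step ((_ , e) ∷ (_ ∷ _)) zero = e
    vertex-step (_ ∷ w) (suc i) = vertex-step w i

    vertex-holds : ∀ {P a b} (w : WalkIn T P a b) i → P (vertex w i)
    vertex-holds [ p ] zero = p
    vertex-holds ((p , _) ∷ w) zero = p
    vertex-holds (_ ∷ w) (suc i) = vertex-holds w i

    IsPath : ∀ {P a b} → WalkIn T P a b → Set
    IsPath w = Injective _≡_ _≡_ (vertex w)

    drop : ∀ {P a b} (w : WalkIn T P a b) i → Σ (WalkIn T P (vertex w i) b) λ w′ → IsPath w → IsPath w′
    drop [ p ] zero = [ p ] , λ path → path
    drop (s ∷ w) zero = s ∷ w , λ path → path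
    drop (s ∷ w) (suc i) with drop w i
    ... | w′ , inherit = w′ , λ path → inherit (suc-injective ∘′ path)

    toPath : ∀ {P a b} → WalkIn T P a b → Σ (WalkIn T P a b) IsPath
    toPath [ p ] = [ p ] , λ { {zero} {zero} _ → refl }
    toPath {P} {a} {b} ((p , e) ∷ w) with toPath w
    ... | w′ , path with any? (λ i → vertex w′ i ≟ a)
    ...   | yes (i , w′ᵢ≡a) =
      subst (λ u → Σ (WalkIn T P u b) IsPath) w′ᵢ≡a (proj₁ (drop w′ i) , proj₂ (drop w′ i) path)
    ...   | no a∉w′ = (p , e) ∷ w′ , extended
      where
      extended : IsPath ((p , e) ∷ w′)
      extended {zero} {zero} _ = refl
      extended {zero} {suc j} eq = ⊥-elim (a∉w′ (j , sym eq))
      extended {suc i} {zero} eq = ⊥-elim (a∉w′ (i , eq))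
      extended {suc i} {suc j} eq = cong suc (path eq)

    -- A walk avoiding x between two distinct neighbours of x closes up to a cycle through x.
    acyclic-detour : ¬ Cycle T → ∀ {x y₁ y₂} → Adj T x y₁ → Adj T y₂ x →
      WalkIn T (λ u → u ≢ x) y₁ y₂ → y₁ ≡ y₂
    acyclic-detour acyclic {x} {y₁} {y₂} x~y₁ y₂~x w with y₁ ≟ y₂ | toPath w
    ... | yes y₁≡y₂ | _ = y₁≡y₂
    ... | no y₁≢y₂ | [ _ ] , _ = ⊥-elim (y₁≢y₂ refl)
    ... | no _ | W@(_ ∷ W′) , path = ⊥-elim (acyclic cycle)
      where
      c : Fin (suc (suc (suc (length W′)))) → Fin t
      c zero = x
      c (suc i) = vertex W i
      c-inj : Injective _≡_ _≡_ c
      c-inj {zero} {zero} _ = refl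
      c-inj {zero} {suc j} eq = ⊥-elim (vertex-holds W j (sym eq))
      c-inj {suc i} {zero} eq = ⊥-elim (vertex-holds W i eq)
      c-inj {suc i} {suc j} eq = cong suc (path eq)
      cycle : Cycle T
      cycle = record
        { l = length W′ ; c = c ; c-inj = c-inj
        ; c-step = λ { zero → x~y₁ ; (suc i) → vertex-step W i }
        ; c-close = subst (λ u → Adj T u x) (sym (vertex-last W)) y₂~x }

    module _ (acyclic : ¬ Cycle T) (f : Fin t → Fin t) (x~fx : ∀ x → Adj T x (f x))
             (f²x≢x : ∀ x → f (f x) ≢ x) where

      private
        iterate-suc : ∀ p u → iterate f u (suc p) ≡ f (iterate f u p)
        iterate-suc zero u = refl
        iterate-suc (suc p) u = iterate-suc p (f u)

        iterate-+ : ∀ a b u → iterate f u (a ℕ.+ b) ≡ iterate f (iterate f u a) b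
        iterate-+ zero b u = refl
        iterate-+ (suc a) b u = iterate-+ a b (f u)

        orbit : ∀ {P : Fin t → Set} q u → (∀ p → p ℕ.≤ q → P (iterate f u p)) → WalkIn T P u (iterate f u q)
        orbit zero u all = [ all 0 z≤n ]
        orbit (suc q) u all = (all 0 z≤n , x~fx u) ∷ orbit q (f u) (λ p p≤q → all (suc p) (s≤s p≤q))

        -- Induction on the period: a returning orbit u, f u, …, u would give a detour around u.
        aperiodic : ∀ D d → d ℕ.≤ D → ∀ u → iterate f u (suc d) ≢ u
        aperiodic D zero _ u fu≡u = irrefl T (subst (Adj T u) fu≡u (x~fx u))
        aperiodic D (suc zero) _ u = f²x≢x u
        aperiodic (suc D) (suc (suc d)) (s≤s d<D) u returns = aperiodic D d (ℕ.<⇒≤ d<D) (f u) (sym fu≡y)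
          where
          y = iterate f (f u) (suc d)
          y~u : Adj T y u
          y~u = subst (Adj T y) (trans (sym (iterate-suc (suc d) (f u))) returns) (x~fx y)
          fu≡y : f u ≡ y
          fu≡y = acyclic-detour acyclic (x~fx u) y~u
            (orbit (suc d) (f u) λ p p≤ → aperiodic D p (ℕ.≤-trans p≤ d<D) u)

      acyclic⇒¬nonbacktracking : Fin t → ⊥
      acyclic⇒¬nonbacktracking x with pigeonhole (ℕ.n<1+n t) (λ (i : Fin (suc t)) → iterate f x (toℕ i))
      ... | i , j , i<j , xᵢ≡xⱼ with ℕ.m≤n⇒∃[o]m+o≡n i<j
      ...   | o , i+1+o≡j = aperiodic o o ℕ.≤-refl (iterate f x (toℕ i)) (begin
        iterate f (iterate f x (toℕ i)) (suc o)  ≡⟨ iterate-+ (toℕ i) (suc o) x ⟨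
        iterate f x (toℕ i ℕ.+ suc o)            ≡⟨ cong (iterate f x) (trans (ℕ.+-suc (toℕ i) o) i+1+o≡j) ⟩
        iterate f x (toℕ j)                      ≡⟨ xᵢ≡xⱼ ⟨
        iterate f x (toℕ i)                      ∎)
        where open ≡-Reasoning

module Branches where

  open import Defs using (Graph; Adj; WalkIn; TreeDecomposition)
  open import Data.Nat.Base using (ℕ)
  open import Data.Bool.Base using (true; false)
  open import Data.Fin.Base using (Fin)
  open import Data.Fin.Subset using (_∈_)
  open import Data.Vec.Base using (lookup)
  open import Data.Vec.Properties using ([]=⇒lookup)
  open import Data.Product.Base using (Σ; _×_; _,_; proj₁; proj₂)
  open import Data.Sum.Base using (inj₁; inj₂)
  open import Data.Unit.Base using (⊤)
  open import Data.Empty using (⊥; ⊥-elim)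
  open import Relation.Binary.PropositionalEquality

  module _ {N : ℕ} {Γ : Graph N} (D : TreeDecomposition Γ) where

    open TreeDecomposition D
    open Walks

    Outside : Fin t → Fin N → Set
    Outside x p = lookup (bag x) p ≡ false

    InBranch : Fin t → Fin t → Fin N → Set
    InBranch x y p = Adj T x y × Σ (Fin t) λ z → WalkIn T (λ u → u ≢ x) y z × p ∈ bag z

    outside≢ : ∀ {x p z} → Outside x p → p ∈ bag z → z ≢ x
    outside≢ out p∈z refl with trans (sym ([]=⇒lookup p∈z)) out
    ... | ()

    towards : ∀ {x p z} → Outside x p → p ∈ bag z → Σ (Fin t) λ y → Adj T x y × WalkIn T (λ u → u ≢ x) y z
    towards {x} {p} {z} out p∈z with lastExit {Q = λ _ → ⊤} x (proj₁ tree x z) (outside≢ out p∈z)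
    ... | inj₁ w = ⊥-elim (proj₂ (head w) refl)
    ... | inj₂ (y , x~y , w) = y , x~y , map proj₂ w

    branch-exists : ∀ {x p} → Outside x p → Σ (Fin t) λ y → InBranch x y p
    branch-exists {p = p} out with covers-vertices p
    ... | z , p∈z with towards out p∈z
    ...   | y , x~y , w = y , x~y , z , w , p∈z

    branch-unique : ∀ {x p y₁ y₂} → Outside x p → InBranch x y₁ p → InBranch x y₂ p → y₁ ≡ y₂
    branch-unique {x} {p} out (x~y₁ , z₁ , w₁ , p∈z₁) (x~y₂ , z₂ , w₂ , p∈z₂) =
      acyclic-detour (proj₂ tree) x~y₁ (Graph.sym T x~y₂)
        (w₁ ++ (map (outside≢ out) (subtree p z₁ z₂ p∈z₁ p∈z₂) ++ reverse w₂))

    private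
      branch-on : ∀ x p b → lookup (bag x) p ≡ b → Fin t
      branch-on x p true _ = x
      branch-on x p false out = proj₁ (branch-exists out)

      branch-on-spec : ∀ {x p} b (eq : lookup (bag x) p ≡ b) → b ≡ false → InBranch x (branch-on x p b eq) p
      branch-on-spec false out refl = proj₂ (branch-exists out)

    -- Vertices inside the bag of x get the junk value x.
    branch : Fin t → Fin N → Fin t
    branch x p = branch-on x p (lookup (bag x) p) refl

    branch-spec : ∀ {x p} → Outside x p → InBranch x (branch x p) p
    branch-spec {x} {p} = branch-on-spec (lookup (bag x) p) refl

    branch-edge : ∀ {x p q} → Adj Γ p q → Outside x p → Outside x q → branch x p ≡ branch x q
    branch-edge {x} {p} {q} p~q outp outq with covers-edges p q p~q
    ... | z , p∈z , q∈z with towards outp p∈z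
    ...   | y , x~y , w = trans (branch-unique outp (branch-spec outp) (x~y , z , w , p∈z))
                                (branch-unique outq (x~y , z , w , q∈z) (branch-spec outq))

    -- The bags containing p avoid x and y, yet would join the y-side of T − x to the x-side of T − y.
    branches-disjoint : ∀ {x y p} → Adj T x y → Outside x p → branch x p ≡ y →
      Outside y p → branch y p ≡ x → ⊥
    branches-disjoint {x} {y} {p} x~y outx bx≡y outy by≡x
      with subst (λ u → InBranch x u p) bx≡y (branch-spec outx) | subst (λ u → InBranch y u p) by≡x (branch-spec outy)
    ... | _ , z₁ , w₁ , p∈z₁ | _ , z₂ , w₂ , p∈z₂
      with lastExit {Q = λ u → u ≢ y} x w₂ (outside≢ outx p∈z₂)
    ...   | inj₁ w = ⊥-elim (proj₂ (head w) refl)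
    ...   | inj₂ (y′ , x~y′ , w₃) = proj₁ (head w₃) (sym y≡y′)
      where
      y≡y′ : y ≡ y′
      y≡y′ = acyclic-detour (proj₂ tree) x~y (Graph.sym T x~y′)
        (w₁ ++ (map (outside≢ outx) (subtree p z₁ z₂ p∈z₁ p∈z₂) ++ reverse (map proj₂ w₃)))

module Product where

  open import Defs using (Graph; Adj; _□_)
  open import Data.Nat.Base using (ℕ)
  open import Data.Fin.Base using (combine)
  open import Data.Fin.Properties using (remQuot-combine)
  open import Data.Product.Base using (_,_; proj₁; proj₂)
  open import Data.Sum.Base using (inj₁; inj₂)
  open import Relation.Binary.PropositionalEquality

  module _ {m n : ℕ} {G : Graph m} {H : Graph n} where

    □-column : ∀ {a a′ v} → Adj G a a′ → Adj (G □ H) (combine a v) (combine a′ v)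
    □-column {a} {a′} {v} a~a′ =
      inj₁ (subst₂ (Adj G) (sym (cong proj₁ e)) (sym (cong proj₁ e′)) a~a′ , trans (cong proj₂ e) (sym (cong proj₂ e′)))
      where
      e = remQuot-combine {m} {n} a v
      e′ = remQuot-combine {m} {n} a′ v

    □-row : ∀ {a v v′} → Adj H v v′ → Adj (G □ H) (combine a v) (combine a v′)
    □-row {a} {v} {v′} v~v′ =
      inj₂ (subst₂ (Adj H) (sym (cong proj₂ e)) (sym (cong proj₂ e′)) v~v′ , trans (cong proj₁ e) (sym (cong proj₁ e′)))
      where
      e = remQuot-combine {m} {n} a v
      e′ = remQuot-combine {m} {n} a v′

module Dominance where

  open import Defs using (Graph; Adj; Separation; order; Side; sA; sS; sB; isA; isS; isB; ℕtoℚ)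
  open import Data.Nat.Base as ℕ using (ℕ; suc; z≤n)
  import Data.Nat.Properties as ℕ
  open import Data.Nat.Solver using (module +-*-Solver)
  open import Data.Rational.Base using (ℚ; _≤_; _<_; _+_; _*_)
  open import Data.Rational.Properties using (_<?_; <-irrefl; ≮⇒≥; +-mono-<; +-monoˡ-≤; module ≤-Reasoning)
  open import Data.Bool.Base using (Bool; true; false; not; _∧_)
  open import Data.Bool.Properties using (∧-zeroʳ; ∧-identityʳ)
  open import Data.Fin.Base using (Fin; toℕ; fromℕ<)
  open import Data.Fin.Properties using (_≟_; toℕ<n; toℕ-fromℕ<; toℕ-injective)
  open import Data.Fin.Subset using (∣_∣)
  open import Data.Vec.Base using (tabulate)
  open import Data.Product.Base using (Σ; _×_; _,_)
  open import Data.Sum.Base using (_⊎_; inj₁; inj₂)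
  open import Data.Empty using (⊥; ⊥-elim)
  open import Function.Base using (_∘_)
  open import Relation.Nullary using (¬_; Dec; yes; no; does)
  open import Relation.Nullary.Decidable using (dec-true; dec-false; does-⇔)
  open import Function.Bundles using (mk⇔)
  open import Relation.Binary.PropositionalEquality
  open Counting
  open ℕtoℚ-Properties

  sideOf : Bool → Bool → Side
  sideOf true _ = sS
  sideOf false true = sA
  sideOf false false = sB

  module _ {m : ℕ} (G : Graph m) where

    -- S a ≡ true marks a as deleted; Closed S P says that P is constant on the components of G − S.
    Closed : ∀ {L : Set} → (Fin m → Bool) → (Fin m → L) → Set
    Closed S P = ∀ {a a′} → Adj G a a′ → S a ≡ false → S a′ ≡ false → P a ≡ P a′

    part : (S P : Fin m → Bool) → ℕ
    part S P = count (λ a → not (S a) ∧ P a)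

    part-split : ∀ S P → part S P ℕ.+ part S (not ∘ P) ≡ count (not ∘ S)
    part-split S P = count-split (not ∘ S) P

    sideOf-no-edge : ∀ {S P} → Closed S P →
      ∀ u v → sideOf (S u) (P u) ≡ sA → sideOf (S v) (P v) ≡ sB → ¬ Adj G u v
    sideOf-no-edge {S} {P} closed u v su sv u~v with S u | P u | S v | P v | closed {u} {v} u~v
    ... | false | true | false | false | closed′ with closed′ refl refl
    ...   | ()

    module _ {t : ℕ} (S : Fin m → Bool) (lab : Fin m → Fin t) where

      below : ℕ → ℕ
      below j = part S (λ a → does (toℕ (lab a) ℕ.<? j))

      class : Fin t → ℕ
      class y = part S (λ a → does (lab a ≟ y))

      below-zero : below 0 ≡ 0
      below-zero = trans (count-cong λ a → ∧-zeroʳ (not (S a))) (count-false m)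

      below-all : below t ≡ count (not ∘ S)
      below-all = count-cong λ a →
        trans (cong (not (S a) ∧_) (dec-true (toℕ (lab a) ℕ.<? t) (toℕ<n (lab a)))) (∧-identityʳ (not (S a)))

      below-suc : ∀ {j} (j<t : j ℕ.< t) → below (suc j) ≡ below j ℕ.+ class (fromℕ< j<t)
      below-suc {j} j<t = trans (sum-cong-≗ λ a → step (not (S a)) (lab a))
        (∑-distrib-+ (bit ∘ λ a → not (S a) ∧ does (toℕ (lab a) ℕ.<? j)) (bit ∘ λ a → not (S a) ∧ does (lab a ≟ y)))
        where
        y = fromℕ< j<t
        y≡j : toℕ y ≡ j
        y≡j = toℕ-fromℕ< j<t
        step : ∀ b ℓ →
          bit (b ∧ does (toℕ ℓ ℕ.<? suc j)) ≡ bit (b ∧ does (toℕ ℓ ℕ.<? j)) ℕ.+ bit (b ∧ does (ℓ ≟ y))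
        step false ℓ = refl
        step true ℓ with ℓ ≟ y
        ... | yes refl = trans (cong bit (dec-true (toℕ y ℕ.<? suc j) (ℕ.≤-reflexive (cong suc y≡j))))
                               (cong (λ b → bit b ℕ.+ 1) (sym (dec-false (toℕ y ℕ.<? j) (ℕ.<-irrefl y≡j))))
        ... | no ℓ≢y = trans (cong bit (does-⇔ (mk⇔ shrink ℕ.m<n⇒m<1+n) (toℕ ℓ ℕ.<? suc j) (toℕ ℓ ℕ.<? j)))
                             (sym (ℕ.+-identityʳ _))
          where
          shrink : toℕ ℓ ℕ.< suc j → toℕ ℓ ℕ.< j
          shrink ℓ<1+j with ℕ.m<1+n⇒m<n∨m≡n ℓ<1+j
          ... | inj₁ ℓ<j = ℓ<j
          ... | inj₂ ℓ≡j = ⊥-elim (ℓ≢y (toℕ-injective (trans ℓ≡j (sym y≡j))))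

  module _ {m k : ℕ} (G : Graph m) (β : ℚ) (robust : (s : Separation G β) → k ℕ.≤ order s)
           (⅔m≤X : ℕtoℚ m + ℕtoℚ m ≤ β * ℕtoℚ m + β * ℕtoℚ m + β * ℕtoℚ m)
           (X+k≤m : β * ℕtoℚ m + ℕtoℚ k ≤ ℕtoℚ m) where

    X : ℚ
    X = β * ℕtoℚ m

    separation-order : ∀ S P → Closed G S P → 1 ℕ.≤ part G S P → 1 ℕ.≤ part G S (not ∘ P) →
      ℕtoℚ (part G S P) ≤ X → ℕtoℚ (part G S (not ∘ P)) ≤ X → k ℕ.≤ count S
    separation-order S P closed 1≤A 1≤B A≤X B≤X = subst (k ℕ.≤_) order≡ (robust separation)
      where
      side : Fin m → Side
      side a = sideOf (S a) (P a)
      A-count : ∣ tabulate (isA ∘ side) ∣ ≡ part G S P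
      A-count = trans (∣tabulate∣≡count (isA ∘ side)) (count-cong λ a → isA-sideOf (S a) (P a))
        where
        isA-sideOf : ∀ s p → isA (sideOf s p) ≡ not s ∧ p
        isA-sideOf true p = refl
        isA-sideOf false true = refl
        isA-sideOf false false = refl
      B-count : ∣ tabulate (isB ∘ side) ∣ ≡ part G S (not ∘ P)
      B-count = trans (∣tabulate∣≡count (isB ∘ side)) (count-cong λ a → isB-sideOf (S a) (P a))
        where
        isB-sideOf : ∀ s p → isB (sideOf s p) ≡ not s ∧ not p
        isB-sideOf true p = refl
        isB-sideOf false true = refl
        isB-sideOf false false = refl
      order≡ : ∣ tabulate (isS ∘ side) ∣ ≡ count S
      order≡ = trans (∣tabulate∣≡count (isS ∘ side)) (count-cong λ a → isS-sideOf (S a) (P a))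
        where
        isS-sideOf : ∀ s p → isS (sideOf s p) ≡ s
        isS-sideOf true p = refl
        isS-sideOf false true = refl
        isS-sideOf false false = refl
      separation : Separation G β
      separation = record
        { side = side
        ; A-nonempty = subst (1 ℕ.≤_) (sym A-count) 1≤A
        ; B-nonempty = subst (1 ℕ.≤_) (sym B-count) 1≤B
        ; A-small = subst (λ c → ℕtoℚ c ≤ X) (sym A-count) A≤X
        ; B-small = subst (λ c → ℕtoℚ c ≤ X) (sym B-count) B≤X
        ; no-edge = sideOf-no-edge G closed }

    unbalanced : ∀ S P → Closed G S P → count S ℕ.< k → X < ℕtoℚ (count (not ∘ S)) → 1 ℕ.≤ part G S P →
      X < ℕtoℚ (part G S P) ⊎ X < ℕtoℚ (part G S (not ∘ P))
    unbalanced S P closed small X<M 1≤A = decide (X <? ℕtoℚ (part G S P)) (X <? ℕtoℚ (part G S (not ∘ P)))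
      where
      decide : Dec (X < ℕtoℚ (part G S P)) → Dec (X < ℕtoℚ (part G S (not ∘ P))) →
        X < ℕtoℚ (part G S P) ⊎ X < ℕtoℚ (part G S (not ∘ P))
      decide (yes X<A) _ = inj₁ X<A
      decide (no _) (yes X<B) = inj₂ X<B
      decide (no X≮A) (no X≮B) =
        ⊥-elim (ℕ.<⇒≱ small (separation-order S P closed 1≤A 1≤B (≮⇒≥ X≮A) (≮⇒≥ X≮B)))
        where
        1≤B : 1 ℕ.≤ part G S (not ∘ P)
        1≤B = ℕ.n≢0⇒n>0 λ B≡0 → X≮A (subst (λ c → X < ℕtoℚ c) (sym (A≡M B≡0)) X<M)
          where
          A≡M : part G S (not ∘ P) ≡ 0 → part G S P ≡ count (not ∘ S)
          A≡M B≡0 = trans (sym (ℕ.+-identityʳ _)) (trans (cong (part G S P ℕ.+_) (sym B≡0)) (part-split G S P))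

    outside-large : ∀ (S : Fin m → Bool) → count S ℕ.< k → X < ℕtoℚ (count (not ∘ S))
    outside-large S small = decide (X <? ℕtoℚ M)
      where
      M = count (not ∘ S)
      decide : Dec (X < ℕtoℚ M) → X < ℕtoℚ M
      decide (yes X<M) = X<M
      decide (no X≮M) = ⊥-elim (<-irrefl {ℕtoℚ m} refl (begin-strict
        ℕtoℚ m                 ≡⟨ cong ℕtoℚ (count-complement S) ⟨
        ℕtoℚ (M ℕ.+ count S)   <⟨ ℕtoℚ-mono-< (ℕ.+-monoʳ-< M small) ⟩
        ℕtoℚ (M ℕ.+ k)         ≡⟨ ℕtoℚ-+ M k ⟩
        ℕtoℚ M + ℕtoℚ k        ≤⟨ +-monoˡ-≤ (ℕtoℚ k) (≮⇒≥ X≮M) ⟩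
        X + ℕtoℚ k             ≤⟨ X+k≤m ⟩
        ℕtoℚ m                 ∎))
        where open ≤-Reasoning

    ¬three-large : ∀ u v w → X < ℕtoℚ u → X < ℕtoℚ v → X < ℕtoℚ w →
      u ℕ.+ v ℕ.+ w ℕ.≤ m ℕ.+ m → ⊥
    ¬three-large u v w X<u X<v X<w u+v+w≤2m = <-irrefl refl (begin-strict
      X + X + X                        <⟨ +-mono-< (+-mono-< X<u X<v) X<w ⟩
      ℕtoℚ u + ℕtoℚ v + ℕtoℚ w         ≡⟨ trans (ℕtoℚ-+ (u ℕ.+ v) w) (cong (_+ ℕtoℚ w) (ℕtoℚ-+ u v)) ⟨
      ℕtoℚ (u ℕ.+ v ℕ.+ w)             ≤⟨ ℕtoℚ-mono-≤ u+v+w≤2m ⟩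
      ℕtoℚ (m ℕ.+ m)                   ≡⟨ ℕtoℚ-+ m m ⟩
      ℕtoℚ m + ℕtoℚ m                  ≤⟨ ⅔m≤X ⟩
      X + X + X                        ∎)
      where open ≤-Reasoning


    module _ {t : ℕ} (S : Fin m → Bool) (lab : Fin m → Fin t) (closed : Closed G S lab) (small : count S ℕ.< k) where

      private
        X<M : X < ℕtoℚ (count (not ∘ S))
        X<M = outside-large S small

        M≤m : count (not ∘ S) ℕ.≤ m
        M≤m = subst (count (not ∘ S) ℕ.≤_) (count-complement S) (ℕ.m≤m+n _ _)

        X≮below-0 : ¬ X < ℕtoℚ (below G S lab 0)
        X≮below-0 X<0 = ¬three-large 0 0 0 X<0′ X<0′ X<0′ z≤n
          where X<0′ = subst (λ c → X < ℕtoℚ c) (below-zero G S lab) X<0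

        -- The class where the prefix counts cross X is large: otherwise either the class or the
        -- prefix below it splits G − S into two sides of size at most X.
        crossing-class : ∀ {j} (j<t : j ℕ.< t) →
          ¬ X < ℕtoℚ (below G S lab j) → X < ℕtoℚ (below G S lab (suc j)) →
          X < ℕtoℚ (class G S lab (fromℕ< j<t))
        crossing-class {j} j<t X≮Bj X<Bj+1 = decide (Bj ℕ.≟ 0)
          where
          y = fromℕ< j<t
          Bj = below G S lab j
          C = class G S lab y
          X<Bj+C : X < ℕtoℚ (Bj ℕ.+ C)
          X<Bj+C = subst (λ c → X < ℕtoℚ c) (below-suc G S lab j<t) X<Bj+1
          1≤C : 1 ℕ.≤ C
          1≤C = ℕ.n≢0⇒n>0 λ C≡0 →
            X≮Bj (subst (λ c → X < ℕtoℚ c) (trans (cong (Bj ℕ.+_) C≡0) (ℕ.+-identityʳ Bj)) X<Bj+C)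
          class-or-rest = unbalanced S (λ a → does (lab a ≟ y))
            (λ a~a′ s s′ → cong (λ ℓ → does (ℓ ≟ y)) (closed a~a′ s s′)) small X<M 1≤C
          rest = part G S (λ a → not (does (lab a ≟ y)))
          decide : Dec (Bj ≡ 0) → X < ℕtoℚ C
          decide (yes Bj≡0) = subst (λ c → X < ℕtoℚ (c ℕ.+ C)) Bj≡0 X<Bj+C
          decide (no Bj≢0) = conclude class-or-rest below-or-above
            where
            below-or-above = unbalanced S (λ a → does (toℕ (lab a) ℕ.<? j))
              (λ a~a′ s s′ → cong (λ ℓ → does (toℕ ℓ ℕ.<? j)) (closed a~a′ s s′)) small X<M (ℕ.n≢0⇒n>0 Bj≢0)
            above = part G S (λ a → not (does (toℕ (lab a) ℕ.<? j)))
            conclude : X < ℕtoℚ C ⊎ X < ℕtoℚ rest → X < ℕtoℚ Bj ⊎ X < ℕtoℚ above → X < ℕtoℚ C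
            conclude (inj₁ X<C) _ = X<C
            conclude (inj₂ _) (inj₁ X<Bj) = ⊥-elim (X≮Bj X<Bj)
            conclude (inj₂ X<rest) (inj₂ X<above) = ⊥-elim (¬three-large rest above (Bj ℕ.+ C) X<rest X<above X<Bj+C (begin
              rest ℕ.+ above ℕ.+ (Bj ℕ.+ C)
                ≡⟨ solve 4 (λ r a b c → r :+ a :+ (b :+ c) := (b :+ a) :+ (c :+ r)) refl rest above Bj C ⟩
              (Bj ℕ.+ above) ℕ.+ (C ℕ.+ rest)     ≡⟨ cong₂ ℕ._+_ (part-split G S _) (part-split G S _) ⟩
              count (not ∘ S) ℕ.+ count (not ∘ S) ≤⟨ ℕ.+-mono-≤ M≤m M≤m ⟩
              m ℕ.+ m                             ∎))
              where
              open ℕ.≤-Reasoning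
              open +-*-Solver

      dominant : Σ (Fin t) λ y → X < ℕtoℚ (class G S lab y)
      dominant = found (crossing (λ j → X < ℕtoℚ (below G S lab j)) (λ j → X <? ℕtoℚ (below G S lab j))
                                 X≮below-0 (subst (λ c → X < ℕtoℚ c) (sym (below-all G S lab)) X<M))
        where
        found : Σ ℕ (λ j → j ℕ.< t × ¬ X < ℕtoℚ (below G S lab j) × X < ℕtoℚ (below G S lab (suc j))) →
          Σ (Fin t) λ y → X < ℕtoℚ (class G S lab y)
        found (j , j<t , X≮Bj , X<Bj+1) = fromℕ< j<t , crossing-class j<t X≮Bj X<Bj+1

module Grid where

  open import Defs using (Graph; Connected; WalkIn; [_]; _∷_; Separation; order; ℕtoℚ)
  open import Data.Nat.Base as ℕ using (ℕ)
  import Data.Nat.Properties as ℕ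
  open import Data.Rational.Base using (ℚ; _≤_; _<_; _+_; _*_; 0ℚ)
  open import Data.Rational.Properties
    using (<-irrefl; <⇒≤; ≤-trans; ≤-reflexive; +-mono-<; +-comm; *-zeroˡ; module ≤-Reasoning)
  open import Data.Bool.Base using (Bool; false; not; _∧_)
  open import Data.Fin.Base using (Fin)
  open import Data.Fin.Properties using (_≟_; any?)
  open import Data.Product.Base using (Σ; _,_; proj₁; proj₂)
  open import Function.Base using (_∘_)
  open import Relation.Nullary using (Dec; yes; no; does)
  open import Relation.Nullary.Decidable using (dec-false; decidable-stable)
  open import Relation.Binary.PropositionalEquality
  open Counting
  open ℕtoℚ-Properties
  open Dominance using (Closed; class; dominant)

  -- The grid vertex (a, v) lies in column v, a copy of G, and in row a, a copy of H.
  module Bag {m n k t : ℕ} (G : Graph m) (H : Graph n) (H-connected : Connected H)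
           (β : ℚ) (robust : (s : Separation G β) → k ℕ.≤ order s)
           (⅔m≤X : ℕtoℚ m + ℕtoℚ m ≤ β * ℕtoℚ m + β * ℕtoℚ m + β * ℕtoℚ m)
           (X+k≤m : β * ℕtoℚ m + ℕtoℚ k ≤ ℕtoℚ m)
           (S : Fin m → Fin n → Bool) (lab : Fin m → Fin n → Fin t)
           (column-closed : ∀ v → Closed G (λ a → S a v) (λ a → lab a v))
           (row-closed : ∀ a → Closed H (S a) (lab a))
           (bag-small : ℕtoℚ (∑[ a < m ] count (S a)) + ℕtoℚ m < β * ℕtoℚ m + β * ℕtoℚ m) where

    X : ℚ
    X = β * ℕtoℚ m

    s : ℕ
    s = ∑[ a < m ] count (S a)

    columnSize : Fin n → ℕ
    columnSize v = count (λ a → S a v)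

    Light : Fin n → Bool
    Light v = does (columnSize v ℕ.<? k)

    columnClass : Fin n → Fin t → ℕ
    columnClass v = class G (λ a → S a v) (λ a → lab a v)

    gridClass : Fin t → ℕ
    gridClass y = ∑[ v < n ] columnClass v y

    row-constant : ∀ a → (∀ v → S a v ≡ false) → ∀ {P v v′} → WalkIn H P v v′ → lab a v ≡ lab a v′
    row-constant a outside [ _ ] = refl
    row-constant a outside ((_ , v~w) ∷ w) =
      trans (row-closed a v~w (outside _) (outside _)) (row-constant a outside w)

    -- A row meeting both classes but not the bag would carry one label across the connected H.
    private
      shared-row-meets-bag : ∀ {v₀ v₁ y₀ y₁} → y₀ ≢ y₁ → ∀ a →
        bit ((not (S a v₀) ∧ does (lab a v₀ ≟ y₀)) ∧ (not (S a v₁) ∧ does (lab a v₁ ≟ y₁))) ℕ.≤ count (S a)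
      shared-row-meets-bag {v₀} {v₁} {y₀} {y₁} y₀≢y₁ a = bit-≤ _ λ shared → ℕ.n≢0⇒n>0 λ empty →
        let lab₀ , lab₁ = ∧-true {not (S a v₀) ∧ does (lab a v₀ ≟ y₀)} shared in
        y₀≢y₁ (begin
          y₀        ≡⟨ does-true (lab a v₀ ≟ y₀) (proj₂ (∧-true {not (S a v₀)} lab₀)) ⟨
          lab a v₀  ≡⟨ row-constant a (count≡0⇒false (S a) empty) (H-connected v₀ v₁) ⟩
          lab a v₁  ≡⟨ does-true (lab a v₁ ≟ y₁) (proj₂ (∧-true {not (S a v₁)} lab₁)) ⟩
          y₁        ∎)
        where open ≡-Reasoning

    columns-agree : ∀ {v₀ v₁ y₀ y₁} → X < ℕtoℚ (columnClass v₀ y₀) → X < ℕtoℚ (columnClass v₁ y₁) →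
      y₀ ≡ y₁
    columns-agree {v₀} {v₁} {y₀} {y₁} X<c₀ X<c₁ = decidable-stable (y₀ ≟ y₁) λ y₀≢y₁ →
      <-irrefl refl (begin-strict
        X + X                                  <⟨ +-mono-< X<c₀ X<c₁ ⟩
        ℕtoℚ c₀ + ℕtoℚ c₁                      ≡⟨ ℕtoℚ-+ c₀ c₁ ⟨
        ℕtoℚ (c₀ ℕ.+ c₁)                       ≤⟨ ℕtoℚ-mono-≤ (count-∧ C₀ C₁) ⟩
        ℕtoℚ (m ℕ.+ count (λ a → C₀ a ∧ C₁ a))  ≤⟨ ℕtoℚ-mono-≤ (ℕ.+-monoʳ-≤ m (shared≤s y₀≢y₁)) ⟩
        ℕtoℚ (m ℕ.+ s)                         ≡⟨ trans (ℕtoℚ-+ m s) (+-comm (ℕtoℚ m) (ℕtoℚ s)) ⟩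
        ℕtoℚ s + ℕtoℚ m                        <⟨ bag-small ⟩
        X + X                                  ∎)
      where
      open ≤-Reasoning
      C₀ C₁ : Fin m → Bool
      C₀ a = not (S a v₀) ∧ does (lab a v₀ ≟ y₀)
      C₁ a = not (S a v₁) ∧ does (lab a v₁ ≟ y₁)
      c₀ = count C₀
      c₁ = count C₁
      shared≤s : y₀ ≢ y₁ → count (λ a → C₀ a ∧ C₁ a) ℕ.≤ s
      shared≤s y₀≢y₁ = ∑-mono-≤ (shared-row-meets-bag y₀≢y₁)

    -- Without light columns the claim is trivial; y₀ only guarantees that a label exists.
    majority : Fin t → Σ (Fin t) λ y → ℕtoℚ (count Light) * X ≤ ℕtoℚ (gridClass y)
    majority y₀ = pick (any? λ v → columnSize v ℕ.<? k)
      where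
      dominant-in : ∀ v → columnSize v ℕ.< k → Σ (Fin t) λ y → X < ℕtoℚ (columnClass v y)
      dominant-in v = dominant G β robust ⅔m≤X X+k≤m (λ a → S a v) (λ a → lab a v) (column-closed v)
      pick : Dec (Σ (Fin n) λ v → columnSize v ℕ.< k) →
        Σ (Fin t) λ y → ℕtoℚ (count Light) * X ≤ ℕtoℚ (gridClass y)
      pick (no none) = y₀ , ≤-trans (≤-reflexive no-light) (ℕtoℚ-nonNeg (gridClass y₀))
        where
        no-light : ℕtoℚ (count Light) * X ≡ 0ℚ
        no-light = trans (cong (λ c → ℕtoℚ c * X) (trans (count-cong heavy) (count-false n))) (*-zeroˡ X)
          where
          heavy : ∀ v → Light v ≡ false
          heavy v = dec-false (columnSize v ℕ.<? k) λ small → none (v , small)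
      pick (yes (v₀ , small₀)) = y , count*≤∑ Light (λ v → columnClass v y) X λ v light →
        <⇒≤ (agrees v (does-true (columnSize v ℕ.<? k) light))
        where
        y = proj₁ (dominant-in v₀ small₀)
        agrees : ∀ v → columnSize v ℕ.< k → X < ℕtoℚ (columnClass v y)
        agrees v small = let y′ , X<c′ = dominant-in v small in
          subst (λ z → X < ℕtoℚ (columnClass v z)) (sym (columns-agree (proj₂ (dominant-in v₀ small₀)) X<c′)) X<c′

    heavy-columns : ℕtoℚ (count (not ∘ Light)) * ℕtoℚ k ≤ ℕtoℚ s
    heavy-columns = subst (λ c → ℕtoℚ (count (not ∘ Light)) * ℕtoℚ k ≤ ℕtoℚ c) (sym (∑-comm (λ a v → bit (S a v))))
      (count*≤∑ (not ∘ Light) columnSize (ℕtoℚ k) λ v heavy →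
        ℕtoℚ-mono-≤ (ℕ.≮⇒≥ (does-false (columnSize v ℕ.<? k) heavy)))

module Arithmetic where

  open import Defs using (ℕtoℚ)
  open import Data.Nat.Base as ℕ using (ℕ; z≤n; s≤s)
  open import Data.Integer.Base as ℤ using (+_)
  open import Data.Rational.Base
  open import Data.Rational.Properties
  open import Data.Rational.Solver using (module +-*-Solver)
  open import Data.Empty using (⊥)
  open import Relation.Binary.PropositionalEquality
  open ℕtoℚ-Properties
  open +-*-Solver

  ⅔ : ℚ
  ⅔ = + 2 / 3

  0<⅔ : 0ℚ < ⅔
  0<⅔ = *<* (ℤ.+<+ (s≤s z≤n))

  1<⅔+⅔ : 1ℚ < ⅔ + ⅔
  1<⅔+⅔ = *<* (ℤ.+<+ (s≤s (s≤s (s≤s (s≤s z≤n)))))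

  p≤q⇒0≤q-p : ∀ {p q} → p ≤ q → 0ℚ ≤ q - p
  p≤q⇒0≤q-p {p} {q} p≤q = subst (_≤ q - p) (+-inverseʳ p) (+-monoˡ-≤ (- p) p≤q)

  +-cancelˡ-< : ∀ r {p q} → r + p < r + q → p < q
  +-cancelˡ-< r rp<rq = ≰⇒> λ q≤p → <-irrefl refl (≤-<-trans (+-monoʳ-≤ r q≤p) rp<rq)

  module Bounds (ε β : ℚ) (⅔≤ε : ⅔ ≤ ε) (⅔≤β : ⅔ ≤ β) (β<1 : β < 1ℚ) (ε<β : ε < β)
           (k n m : ℕ) (1≤m : 1 ℕ.≤ m) (kn≤m : k ℕ.* n ℕ.≤ m)
           .{{_ : NonZero (1ℚ - β)}} (n-large : 1ℚ ÷ (1ℚ - β) ≤ ℕtoℚ n) .{{_ : NonZero β}} where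

    X : ℚ
    X = β * ℕtoℚ m

    ratio : ℚ
    ratio = ε ÷ β

    β-positive : Positive β
    β-positive = positive (<-≤-trans 0<⅔ ⅔≤β)

    ε-nonNeg : 0ℚ ≤ ε
    ε-nonNeg = ≤-trans (<⇒≤ 0<⅔) ⅔≤ε

    ε≡ratio*β : ε ≡ ratio * β
    ε≡ratio*β = sym (trans (*-assoc ε (1/ β) β) (trans (cong (ε *_) (*-inverseˡ β)) (*-identityʳ ε)))

    instance
      1-β-nonNeg : NonNegative (1ℚ - β)
      1-β-nonNeg = nonNegative (p≤q⇒0≤q-p (<⇒≤ β<1))

      ratio-nonNeg : NonNegative ratio
      ratio-nonNeg = nonNegative (*-cancelʳ-≤-pos {0ℚ} {ratio} β {{β-positive}} (begin
        0ℚ * β       ≡⟨ *-zeroˡ β ⟩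
        0ℚ           ≤⟨ ε-nonNeg ⟩
        ε            ≡⟨ ε≡ratio*β ⟩
        ratio * β    ∎))
        where open ≤-Reasoning

      m-positive : Positive (ℕtoℚ m)
      m-positive = positive (<-≤-trans (*<* (ℤ.+<+ (s≤s z≤n))) (ℕtoℚ-mono-≤ 1≤m))

    ⅔≤ratio : ⅔ ≤ ratio
    ⅔≤ratio = begin
      ⅔            ≤⟨ ⅔≤ε ⟩
      ε            ≡⟨ ε≡ratio*β ⟩
      ratio * β    ≤⟨ *-monoˡ-≤-nonNeg ratio (<⇒≤ β<1) ⟩
      ratio * 1ℚ   ≡⟨ *-identityʳ ratio ⟩
      ratio        ∎
      where open ≤-Reasoning

    instance
      1-ratio-nonNeg : NonNegative (1ℚ - ratio)
      1-ratio-nonNeg = nonNegative (p≤q⇒0≤q-p (<⇒≤ ratio<1))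
        where
        open ≤-Reasoning
        ratio<1 : ratio < 1ℚ
        ratio<1 = *-cancelʳ-<-nonNeg β {{pos⇒nonNeg β {{β-positive}}}} {ratio} {1ℚ} (begin-strict
          ratio * β    ≡⟨ ε≡ratio*β ⟨
          ε            <⟨ ε<β ⟩
          β            ≡⟨ *-identityˡ β ⟨
          1ℚ * β       ∎)

    ⅔m≤X : ℕtoℚ m + ℕtoℚ m ≤ X + X + X
    ⅔m≤X = begin
      ℕtoℚ m + ℕtoℚ m
        ≡⟨ solve 1 (λ M → M :+ M := con ⅔ :* M :+ con ⅔ :* M :+ con ⅔ :* M) refl (ℕtoℚ m) ⟩
      ⅔ * ℕtoℚ m + ⅔ * ℕtoℚ m + ⅔ * ℕtoℚ m
        ≤⟨ +-mono-≤ (+-mono-≤ ⅔m≤βm ⅔m≤βm) ⅔m≤βm ⟩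
      X + X + X ∎
      where
      open ≤-Reasoning
      ⅔m≤βm = *-monoʳ-≤-nonNeg (ℕtoℚ m) {{nonNegative (ℕtoℚ-nonNeg m)}} ⅔≤β

    X+k≤m : X + ℕtoℚ k ≤ ℕtoℚ m
    X+k≤m = begin
      X + ℕtoℚ k                       ≤⟨ +-monoʳ-≤ X k≤[1-β]m ⟩
      β * ℕtoℚ m + (1ℚ - β) * ℕtoℚ m   ≡⟨ solve 2 (λ b M → b :* M :+ (con 1ℚ :- b) :* M := M) refl β (ℕtoℚ m) ⟩
      ℕtoℚ m                           ∎
      where
      open ≤-Reasoning
      1≤[1-β]n : 1ℚ ≤ (1ℚ - β) * ℕtoℚ n
      1≤[1-β]n = begin
        1ℚ                                ≡⟨ *-inverseʳ (1ℚ - β) ⟨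
        (1ℚ - β) * 1/ (1ℚ - β)            ≡⟨ cong ((1ℚ - β) *_) (*-identityˡ (1/ (1ℚ - β))) ⟨
        (1ℚ - β) * (1ℚ ÷ (1ℚ - β))        ≤⟨ *-monoˡ-≤-nonNeg (1ℚ - β) n-large ⟩
        (1ℚ - β) * ℕtoℚ n                 ∎
      k≤[1-β]m : ℕtoℚ k ≤ (1ℚ - β) * ℕtoℚ m
      k≤[1-β]m = begin
        ℕtoℚ k                              ≡⟨ *-identityʳ (ℕtoℚ k) ⟨
        ℕtoℚ k * 1ℚ                         ≤⟨ *-monoˡ-≤-nonNeg (ℕtoℚ k) {{nonNegative (ℕtoℚ-nonNeg k)}} 1≤[1-β]n ⟩
        ℕtoℚ k * ((1ℚ - β) * ℕtoℚ n)
          ≡⟨ solve 3 (λ K b N → K :* ((con 1ℚ :- b) :* N) := (con 1ℚ :- b) :* (K :* N)) refl (ℕtoℚ k) β (ℕtoℚ n) ⟩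
        (1ℚ - β) * (ℕtoℚ k * ℕtoℚ n)        ≡⟨ cong ((1ℚ - β) *_) (ℕtoℚ-* k n) ⟨
        (1ℚ - β) * ℕtoℚ (k ℕ.* n)           ≤⟨ *-monoˡ-≤-nonNeg (1ℚ - β) (ℕtoℚ-mono-≤ kn≤m) ⟩
        (1ℚ - β) * ℕtoℚ m                   ∎

    bag-small : ∀ s → ℕtoℚ s < (1ℚ - ratio) * ℕtoℚ (k ℕ.* n) → ℕtoℚ s + ℕtoℚ m < X + X
    bag-small s s<ckn = begin-strict
      ℕtoℚ s + ℕtoℚ m
        <⟨ +-monoˡ-< (ℕtoℚ m) s<ckn ⟩
      (1ℚ - ratio) * ℕtoℚ (k ℕ.* n) + ℕtoℚ m
        ≤⟨ +-monoˡ-≤ (ℕtoℚ m) (*-monoˡ-≤-nonNeg (1ℚ - ratio) (ℕtoℚ-mono-≤ kn≤m)) ⟩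
      (1ℚ - ratio) * ℕtoℚ m + ℕtoℚ m
        ≤⟨ +-monoˡ-≤ (ℕtoℚ m) (*-monoʳ-≤-nonNeg (ℕtoℚ m) {{m≥0}} (+-monoʳ-≤ 1ℚ (neg-antimono-≤ ⅔≤ratio))) ⟩
      (1ℚ - ⅔) * ℕtoℚ m + ℕtoℚ m
        ≡⟨ solve 1 (λ M → (con 1ℚ :- con ⅔) :* M :+ M := con ⅔ :* M :+ con ⅔ :* M) refl (ℕtoℚ m) ⟩
      ⅔ * ℕtoℚ m + ⅔ * ℕtoℚ m
        ≤⟨ +-mono-≤ ⅔m≤βm ⅔m≤βm ⟩
      X + X ∎
      where
      open ≤-Reasoning
      m≥0 = nonNegative (ℕtoℚ-nonNeg m)
      ⅔m≤βm = *-monoʳ-≤-nonNeg (ℕtoℚ m) {{m≥0}} ⅔≤β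

    -- With b heavy columns of at least k bag vertices each, b < (1 − ratio) n, so g > ratio · n.
    many-light-columns : ∀ s b g → b ℕ.+ g ≡ n → ℕtoℚ b * ℕtoℚ k ≤ ℕtoℚ s →
      ℕtoℚ s < (1ℚ - ratio) * ℕtoℚ (k ℕ.* n) → ε * ℕtoℚ (m ℕ.* n) < ℕtoℚ g * X
    many-light-columns s b g b+g≡n bk≤s s<ckn = begin-strict
      ε * ℕtoℚ (m ℕ.* n)                 ≡⟨ cong₂ _*_ ε≡ratio*β (ℕtoℚ-* m n) ⟩
      ratio * β * (ℕtoℚ m * ℕtoℚ n)
        ≡⟨ solve 4 (λ r b M N → r :* b :* (M :* N) := r :* N :* (b :* M)) refl ratio β (ℕtoℚ m) (ℕtoℚ n) ⟩
      ratio * ℕtoℚ n * X                 <⟨ *-monoˡ-<-pos X {{pos*pos⇒pos β {{β-positive}} (ℕtoℚ m)}} ratio*n<g ⟩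
      ℕtoℚ g * X                         ∎
      where
      open ≤-Reasoning
      b<cn : ℕtoℚ b < (1ℚ - ratio) * ℕtoℚ n
      b<cn = *-cancelʳ-<-nonNeg (ℕtoℚ k) {{nonNegative (ℕtoℚ-nonNeg k)}} (begin-strict
        ℕtoℚ b * ℕtoℚ k                        ≤⟨ bk≤s ⟩
        ℕtoℚ s                                 <⟨ s<ckn ⟩
        (1ℚ - ratio) * ℕtoℚ (k ℕ.* n)          ≡⟨ cong ((1ℚ - ratio) *_) (ℕtoℚ-* k n) ⟩
        (1ℚ - ratio) * (ℕtoℚ k * ℕtoℚ n)
          ≡⟨ solve 3 (λ c K N → c :* (K :* N) := c :* N :* K) refl (1ℚ - ratio) (ℕtoℚ k) (ℕtoℚ n) ⟩
        (1ℚ - ratio) * ℕtoℚ n * ℕtoℚ k         ∎)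
      ratio*n<g : ratio * ℕtoℚ n < ℕtoℚ g
      ratio*n<g = +-cancelˡ-< (ℕtoℚ b) (begin-strict
        ℕtoℚ b + ratio * ℕtoℚ n                  <⟨ +-monoˡ-< (ratio * ℕtoℚ n) b<cn ⟩
        (1ℚ - ratio) * ℕtoℚ n + ratio * ℕtoℚ n
          ≡⟨ solve 2 (λ r N → (con 1ℚ :- r) :* N :+ r :* N := N) refl ratio (ℕtoℚ n) ⟩
        ℕtoℚ n                                   ≡⟨ trans (cong ℕtoℚ (sym b+g≡n)) (ℕtoℚ-+ b g) ⟩
        ℕtoℚ b + ℕtoℚ g                          ∎)

    0≤εN : 0ℚ ≤ ε * ℕtoℚ (m ℕ.* n)
    0≤εN = nonNegative⁻¹ _ {{nonNeg*nonNeg⇒nonNeg ε {{nonNegative ε-nonNeg}}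
                                                  (ℕtoℚ (m ℕ.* n)) {{nonNegative (ℕtoℚ-nonNeg (m ℕ.* n))}}}}

    majorities-overlap : ∀ c₁ c₂ → ε * ℕtoℚ (m ℕ.* n) < ℕtoℚ c₁ → ε * ℕtoℚ (m ℕ.* n) < ℕtoℚ c₂ →
      c₁ ℕ.+ c₂ ℕ.≤ m ℕ.* n → ⊥
    majorities-overlap c₁ c₂ εN<c₁ εN<c₂ c₁+c₂≤N = <-irrefl refl (begin-strict
      N                        ≡⟨ *-identityˡ N ⟨
      1ℚ * N                   ≤⟨ *-monoʳ-≤-nonNeg N {{nonNegative (ℕtoℚ-nonNeg (m ℕ.* n))}}
                                                     (≤-trans (<⇒≤ 1<⅔+⅔) (+-mono-≤ ⅔≤ε ⅔≤ε)) ⟩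
      (ε + ε) * N              ≡⟨ *-distribʳ-+ N ε ε ⟩
      ε * N + ε * N            <⟨ +-mono-< εN<c₁ εN<c₂ ⟩
      ℕtoℚ c₁ + ℕtoℚ c₂        ≡⟨ ℕtoℚ-+ c₁ c₂ ⟨
      ℕtoℚ (c₁ ℕ.+ c₂)         ≤⟨ ℕtoℚ-mono-≤ c₁+c₂≤N ⟩
      N                        ∎)
      where
      open ≤-Reasoning
      N = ℕtoℚ (m ℕ.* n)

module NarrowDecomposition where

  open import Defs
  open import Data.Nat.Base as ℕ using (ℕ; suc)
  import Data.Nat.Properties as ℕ
  open import Data.Rational.Base using (ℚ; _≤_; _<_; _+_; _*_; _-_; _÷_; 1ℚ; NonZero)
  open import Data.Rational.Properties using (≤-<-trans; <-≤-trans; +-monoʳ-<; module ≤-Reasoning)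
  open import Data.Rational.Solver using (module +-*-Solver)
  open import Data.Bool.Base using (Bool; true; not; _∧_)
  open import Data.Fin.Base using (Fin; zero; suc; combine; fromℕ<)
  open import Data.Fin.Properties using (_≟_)
  open import Data.Fin.Subset using (∣_∣)
  open import Data.Vec.Base using (lookup)
  open import Data.Product.Base using (Σ; _,_; proj₁; proj₂)
  open import Data.Empty using (⊥)
  open import Function.Base using (_∘_)
  open import Relation.Nullary using (does)
  open import Relation.Binary.PropositionalEquality
  open Counting
  open ℕtoℚ-Properties
  open Walks using (acyclic⇒¬nonbacktracking)
  open Branches
  open Product
  open Arithmetic using (⅔; module Bounds)

  ≤-maxOver : ∀ t (f : Fin t → ℕ) x → f x ℕ.≤ maxOver t f
  ≤-maxOver (suc t) f zero = ℕ.m≤m⊔n _ _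
  ≤-maxOver (suc t) f (suc x) = ℕ.≤-trans (≤-maxOver t (f ∘ suc) x) (ℕ.m≤n⊔m _ _)

  module _ (ε β : ℚ) (⅔≤ε : ⅔ ≤ ε) (⅔≤β : ⅔ ≤ β) (β<1 : β < 1ℚ) (ε<β : ε < β)
           (k n m : ℕ) (1≤n : 1 ℕ.≤ n) (1≤m : 1 ℕ.≤ m) (kn≤m : k ℕ.* n ℕ.≤ m)
           .{{_ : NonZero (1ℚ - β)}} (n-large : 1ℚ ÷ (1ℚ - β) ≤ ℕtoℚ n)
           (G : Graph m) (H : Graph n) (H-connected : Connected H)
           (robust : (s : Separation G β) → k ℕ.≤ order s) .{{_ : NonZero β}}
           (D : TreeDecomposition (G □ H))
           (narrow : ℕtoℚ (width D) < (1ℚ - ε ÷ β) * ℕtoℚ (k ℕ.* n) - 1ℚ) where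

    open TreeDecomposition D
    open Bounds ε β ⅔≤ε ⅔≤β β<1 ε<β k n m 1≤m kn≤m n-large

    inBag : Fin t → Fin m → Fin n → Bool
    inBag x a v = lookup (bag x) (combine a v)

    label : Fin t → Fin m → Fin n → Fin t
    label x a v = branch D x (combine a v)

    bag-bound : ∀ x → ℕtoℚ (∑[ a < m ] count (inBag x a)) < (1ℚ - ratio) * ℕtoℚ (k ℕ.* n)
    bag-bound x = begin-strict
      ℕtoℚ (∑[ a < m ] count (inBag x a))
        ≡⟨ cong ℕtoℚ (trans (∣p∣≡count (bag x)) (∑-combine m n (bit ∘ lookup (bag x)))) ⟨
      ℕtoℚ ∣ bag x ∣
        ≤⟨ ℕtoℚ-mono-≤ (ℕ.≤-trans (≤-maxOver t (λ z → ∣ bag z ∣) x) (ℕ.m≤n+m∸n _ 1)) ⟩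
      ℕtoℚ (1 ℕ.+ width D)
        ≡⟨ ℕtoℚ-+ 1 (width D) ⟩
      1ℚ + ℕtoℚ (width D)
        <⟨ +-monoʳ-< 1ℚ narrow ⟩
      1ℚ + ((1ℚ - ratio) * ℕtoℚ (k ℕ.* n) - 1ℚ)
        ≡⟨ solve 1 (λ q → con 1ℚ :+ (q :- con 1ℚ) := q) refl ((1ℚ - ratio) * ℕtoℚ (k ℕ.* n)) ⟩
      (1ℚ - ratio) * ℕtoℚ (k ℕ.* n) ∎
      where
      open ≤-Reasoning
      open +-*-Solver

    module Node (x : Fin t) = Grid.Bag G H H-connected β robust ⅔m≤X X+k≤m (inBag x) (label x)
      (λ v a~a′ → branch-edge D (□-column {G = G} {H} a~a′))
      (λ a v~v′ → branch-edge D (□-row {G = G} {H} v~v′))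
      (bag-small (∑[ a < m ] count (inBag x a)) (bag-bound x))

    heavy-branch : ∀ x → Σ (Fin t) λ y → ε * ℕtoℚ (m ℕ.* n) < ℕtoℚ (Node.gridClass x y)
    heavy-branch x = proj₁ (majority x) , <-≤-trans εN<light*X (proj₂ (majority x))
      where
      open Node x using (s; Light; majority; heavy-columns)
      εN<light*X = many-light-columns s (count (not ∘ Light)) (count Light) (count-complement Light) heavy-columns
                                      (bag-bound x)

    class⇒adjacent : ∀ x y → 0 ℕ.< Node.gridClass x y → Adj T x y
    class⇒adjacent x y 0<class =
      let v , 0<column = ∑-positive (λ v → Node.columnClass x v y) 0<class
          a , labelled = count-positive (λ a → not (inBag x a v) ∧ does (label x a v ≟ y)) 0<column
          outside , label≡y = not∧-true {inBag x a v} labelled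
      in subst (Adj T x) (does-true (label x a v ≟ y) label≡y) (proj₁ (branch-spec D outside))

    branches-exclusive : ∀ x y → Adj T x y → Node.gridClass x y ℕ.+ Node.gridClass y x ℕ.≤ m ℕ.* n
    branches-exclusive x y x~y = begin
      Node.gridClass x y ℕ.+ Node.gridClass y x
        ≡⟨ ∑-distrib-+ (λ v → Node.columnClass x v y) (λ v → Node.columnClass y v x) ⟨
      ∑[ v < n ] (Node.columnClass x v y ℕ.+ Node.columnClass y v x)
        ≤⟨ ∑-mono-≤ (λ v → count-disjoint _ _ λ a → disjoint a v) ⟩
      ∑[ v < n ] m
        ≡⟨ trans (∑-const n m) (ℕ.*-comm n m) ⟩
      m ℕ.* n ∎
      where
      open ℕ.≤-Reasoning
      disjoint : ∀ a v → not (inBag x a v) ∧ does (label x a v ≟ y) ≡ true →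
        not (inBag y a v) ∧ does (label y a v ≟ x) ≡ true → ⊥
      disjoint a v at-x at-y =
        let out-x , to-y = not∧-true {inBag x a v} at-x
            out-y , to-x = not∧-true {inBag y a v} at-y
        in branches-disjoint D x~y out-x (does-true (label x a v ≟ y) to-y)
                                   out-y (does-true (label y a v ≟ x) to-x)

    next : Fin t → Fin t
    next x = proj₁ (heavy-branch x)

    next-adjacent : ∀ x → Adj T x (next x)
    next-adjacent x = class⇒adjacent x (next x) (ℕtoℚ-cancel-< (≤-<-trans 0≤εN (proj₂ (heavy-branch x))))

    next-not-back : ∀ x → next (next x) ≢ x
    next-not-back x next²x≡x = majorities-overlap (Node.gridClass x (next x)) (Node.gridClass (next x) x)
      (proj₂ (heavy-branch x))
      (subst (λ z → ε * ℕtoℚ (m ℕ.* n) < ℕtoℚ (Node.gridClass (next x) z)) next²x≡x (proj₂ (heavy-branch (next x))))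
      (branches-exclusive x (next x) (next-adjacent x))

    impossible : ⊥
    impossible = acyclic⇒¬nonbacktracking (proj₂ tree) next next-adjacent next-not-back
      (proj₁ (covers-vertices (combine (fromℕ< 1≤m) (fromℕ< 1≤n))))

open import Defs
open import Data.Nat using (ℕ)
open import Data.Integer using (+_)
open import Data.Rational using (ℚ; _≤_; _<_; _*_; _-_; _÷_; _/_; 1ℚ; NonZero)
open import Data.Rational.Properties using (≮⇒≥)

theorem25 : (ε β : ℚ) → (+ 2 / 3) ≤ ε → ε < 1ℚ → (+ 2 / 3) ≤ β → β < 1ℚ → ε < β →
    (k n m : ℕ) → 1 Data.Nat.≤ k → 1 Data.Nat.≤ n → 1 Data.Nat.≤ m → k Data.Nat.* n Data.Nat.≤ m →
    .{{_ : NonZero (1ℚ - β)}} → (1ℚ ÷ (1ℚ - β)) ≤ ℕtoℚ n →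
    (G : Graph m) (H : Graph n) → Connected G → Connected H →
    ((s : Separation G β) → k Data.Nat.≤ order s) →
    .{{_ : NonZero β}} → TwAtLeast (G □ H) ((1ℚ - (ε ÷ β)) * ℕtoℚ (k Data.Nat.* n) - 1ℚ)
theorem25 ε β ⅔≤ε _ ⅔≤β β<1 ε<β k n m _ 1≤n 1≤m kn≤m n-large G H _ H-connected robust D =
  ≮⇒≥ (NarrowDecomposition.impossible ε β ⅔≤ε ⅔≤β β<1 ε<β k n m 1≤n 1≤m kn≤m n-large G H H-connected robust D)
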